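{- If a strongly regular graph $G$ on $n$ vertices is closed distance magic, then $G\cong K_n$.
   Context: An $r$-regular graph is $(r,a,b)$-strongly regular if every pair of adjacent vertices has exactly $a\ge 0$ common neighbors and every pair of non-adjacent vertices has exactly $b\ge 1$ common neighbors; a strongly regular graph is one that is $(r,a,b)$-strongly regular for some such parameters. A graph on $n$ vertices is closed distance magic if there is a bijection $\ell\colon V\to\{1,\dots,n\}$ and a positive integer $k'$ such that the sum of $\ell$ over the closed neighborhood $N[x]$ of every vertex $x$ equals $k'$. -}

module Defs where

open import Data.Nat using (ℕ; suc; _+_; _≥_)
open import Data.Fin using (Fin; toℕ)
open import Data.Bool using (Bool; true; false; if_then_else_)
open import Data.List using (List; filter; length; map)
open import Data.Nat.ListAction using (sum)
open import Data.List using () renaming (allFin to allFinL)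
open import Data.Product using (Σ; _×_; ∃-syntax)
open import Relation.Binary.PropositionalEquality using (_≡_; _≢_)
open import Relation.Nullary using (¬_)
open import Function.Bundles using (Bijection)

record Graph (n : ℕ) : Set where
  field
    adj   : Fin n → Fin n → Bool
    adj-sym : ∀ x y → adj x y ≡ adj y x
    adj-irrefl : ∀ x → adj x x ≡ false
open Graph public

Adj : ∀ {n} → Graph n → Fin n → Fin n → Set
Adj G x y = adj G x y ≡ true

degree : ∀ {n} → Graph n → Fin n → ℕ
degree {n} G x = length (filter (λ y → adj G x y Data.Bool.≟ true) (allFinL n))
  where import Data.Bool

commonNbrs : ∀ {n} → Graph n → Fin n → Fin n → ℕ
commonNbrs {n} G x y =
  length (filter (λ z → (adj G x z Data.Bool.∧ adj G y z) Data.Bool.≟ true) (allFinL n))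
  where import Data.Bool

Regular : ∀ {n} → Graph n → ℕ → Set
Regular G r = ∀ x → degree G x ≡ r

-- G is (r,a,b)-strongly regular (a ≥ 0 automatic in ℕ, b ≥ 1 required)
StronglyRegularWith : ∀ {n} → Graph n → ℕ → ℕ → ℕ → Set
StronglyRegularWith G r a b =
  Regular G r × b ≥ 1
  × (∀ x y → Adj G x y → commonNbrs G x y ≡ a)
  × (∀ x y → x ≢ y → ¬ Adj G x y → commonNbrs G x y ≡ b)

StronglyRegular : ∀ {n} → Graph n → Set
StronglyRegular G = ∃[ r ] ∃[ a ] ∃[ b ] StronglyRegularWith G r a b

closedNbhdSum : ∀ {n} → Graph n → (Fin n → ℕ) → Fin n → ℕ
closedNbhdSum {n} G f x =
  sum (map (λ y → if adj G x y then f y else 0) (allFinL n)) + f x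

-- closed distance magic: a bijection ℓ : V → {1,…,n} (encoded as
-- σ : Fin n ↔ Fin n with ℓ v = toℕ (σ v) + 1) and a positive k' with
-- every closed-neighbourhood sum equal to k'.
ClosedDistanceMagic : ∀ {n} → Graph n → Set
ClosedDistanceMagic {n} G =
  Σ (Bijection (≡-setoid (Fin n)) (≡-setoid (Fin n))) λ σ →
  ∃[ k' ] (k' ≥ 1 × (∀ x → closedNbhdSum G (λ v → suc (toℕ (Bijection.to σ v))) x ≡ k'))
  where open import Relation.Binary.PropositionalEquality using () renaming (setoid to ≡-setoid)

_≅_ : ∀ {n} → Graph n → Graph n → Set
_≅_ {n} G H =
  Σ (Bijection (≡-setoid (Fin n)) (≡-setoid (Fin n))) λ φ →
  ∀ x y → adj G x y ≡ adj H (Bijection.to φ x) (Bijection.to φ y)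
  where open import Relation.Binary.PropositionalEquality using () renaming (setoid to ≡-setoid)

complete : (n : ℕ) → Graph n
complete n = record
  { adj = λ x y → not ⌊ x ≟ y ⌋
  ; adj-sym = λ x y → cong not (≟-sym x y)
  ; adj-irrefl = λ x → cong not (≟-refl x)
  }
  where
  open import Data.Bool using (not)
  open import Data.Fin using (_≟_)
  open import Relation.Nullary.Decidable using (⌊_⌋; yes; no)
  open import Relation.Binary.PropositionalEquality using (cong; refl; sym)
  ≟-refl : ∀ (x : Fin n) → ⌊ x ≟ x ⌋ ≡ true
  ≟-refl x with x ≟ x
  ... | yes _ = refl
  ... | no ¬p = Data.Empty.⊥-elim (¬p refl) where import Data.Empty
  ≟-sym : ∀ (x y : Fin n) → ⌊ x ≟ y ⌋ ≡ ⌊ y ≟ x ⌋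
  ≟-sym x y with x ≟ y | y ≟ x
  ... | yes _ | yes _ = refl
  ... | no _ | no _ = refl
  ... | yes p | no q = Data.Empty.⊥-elim (q (sym p)) where import Data.Empty
  ... | no p | yes q = Data.Empty.⊥-elim (p (sym q)) where import Data.Empty

-- Let C = I + A be the closed adjacency matrix. Closed distance magic says Cℓ = k'·𝟏,
-- hence C²ℓ = (r+1)k'·𝟏; strong regularity says C² = (r+1)I + (a+2)A + b(J−I−A).
-- Comparing the two at a vertex x, and using that ∑_{z≁x, z≠x} ℓ z is the same for all x,
-- gives (a+2)·(Aℓ)_x + const = (r+1)·(Aℓ)_x. Two vertices with different labels have
-- different (Aℓ)_x, so r = a+1: adjacent vertices have the same closed neighbourhood.
-- Then a common neighbour of two non-adjacent vertices (b ≥ 1) makes them adjacent.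
module Submission where

open import Defs
open import Data.Bool using (Bool; true; false; if_then_else_; _∧_; _∨_; not)
import Data.Bool as Bool
open import Data.Bool.Properties using (not-¬)
open import Data.Empty using (⊥-elim)
open import Data.Fin using (Fin; zero; suc; toℕ; _≟_)
open import Data.Fin.Properties using (toℕ-injective)
open import Data.List using (filter; length; map; tabulate)
import Data.Nat.ListAction as List
open import Data.Nat using (ℕ; zero; suc; _+_; _*_; _≤_; _<_; z≤n; s≤s)
open import Data.Nat.Properties hiding (_≟_)
open import Data.Nat.Tactic.RingSolver using (solve-∀)
open import Algebra.Properties.Semiring.Sum +-*-semiring
  using (sum; sum-syntax; sum-cong-≗; sum-replicate-zero; ∑-distrib-+; ∑-comm; *-distribˡ-sum; *-distribʳ-sum)
open import Data.Product using (∃; _×_; _,_)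
open import Data.Sum using (_⊎_; inj₁; inj₂; map₁; [_,_]′)
open import Function using (_∘_; id)
open import Function.Bundles using (Bijection)
open import Function.Construct.Identity using (⤖-id)
open import Relation.Binary.PropositionalEquality
open import Relation.Nullary using (yes; no; ¬_; contradiction)
open import Relation.Nullary.Decidable using (⌊_⌋)

⟦_⟧ : Bool → ℕ
⟦ true ⟧ = 1
⟦ false ⟧ = 0

⟦∧⟧≡* : ∀ p q → ⟦ p ∧ q ⟧ ≡ ⟦ p ⟧ * ⟦ q ⟧
⟦∧⟧≡* true true = refl
⟦∧⟧≡* true false = refl
⟦∧⟧≡* false q = refl

if-then-0≡⟦⟧* : ∀ p v → (if p then v else 0) ≡ ⟦ p ⟧ * v
if-then-0≡⟦⟧* true v = sym (+-identityʳ v)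
if-then-0≡⟦⟧* false v = refl

⟦⟧≤1 : ∀ p → ⟦ p ⟧ ≤ 1
⟦⟧≤1 true = s≤s z≤n
⟦⟧≤1 false = z≤n

⟦⟧≡1⇒true : ∀ {p} → ⟦ p ⟧ ≡ 1 → p ≡ true
⟦⟧≡1⇒true {true} _ = refl

⟦⟧*⟦⟧-positive : ∀ p q → 0 < ⟦ p ⟧ * ⟦ q ⟧ → p ≡ true × q ≡ true
⟦⟧*⟦⟧-positive true true _ = refl , refl

length-filter-tabulate : ∀ {m n} (p : Fin m → Bool) (g : Fin n → Fin m) →
  length (filter (λ y → p y Bool.≟ true) (tabulate g)) ≡ ∑[ i < n ] ⟦ p (g i) ⟧
length-filter-tabulate {n = zero} p g = refl
length-filter-tabulate {n = suc n} p g with p (g zero)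
... | true = cong suc (length-filter-tabulate p (g ∘ suc))
... | false = length-filter-tabulate p (g ∘ suc)

sum-map-tabulate : ∀ {m n} (f : Fin m → ℕ) (g : Fin n → Fin m) →
  List.sum (map f (tabulate g)) ≡ ∑[ i < n ] f (g i)
sum-map-tabulate {n = zero} f g = refl
sum-map-tabulate {n = suc n} f g = cong (f (g zero) +_) (sum-map-tabulate f (g ∘ suc))

δ : ∀ {n} → Fin n → Fin n → ℕ
δ x y = ⟦ ⌊ x ≟ y ⌋ ⟧

δ-refl : ∀ {n} (x : Fin n) → δ x x ≡ 1
δ-refl x with x ≟ x
... | yes _ = refl
... | no x≢x = ⊥-elim (x≢x refl)

δ-≢ : ∀ {n} {x y : Fin n} → x ≢ y → δ x y ≡ 0
δ-≢ {x = x} {y} x≢y with x ≟ y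
... | yes x≡y = ⊥-elim (x≢y x≡y)
... | no _ = refl

δ-sym : ∀ {n} (x y : Fin n) → δ x y ≡ δ y x
δ-sym x y with x ≟ y
... | yes refl = sym (δ-refl x)
... | no x≢y = sym (δ-≢ (x≢y ∘ sym))

∑-δ : ∀ {n} (x : Fin n) (f : Fin n → ℕ) → ∑[ z < n ] (δ x z * f z) ≡ f x
∑-δ {suc n} zero f = begin
  1 * f zero + ∑[ z < n ] (0 * f (suc z)) ≡⟨ cong₂ _+_ (*-identityˡ (f zero)) (sum-replicate-zero n) ⟩
  f zero + 0                              ≡⟨ +-identityʳ (f zero) ⟩
  f zero                                  ∎
  where open ≡-Reasoning
∑-δ {suc n} (suc x) f = trans (sum-cong-≗ δ-suc) (∑-δ x (f ∘ suc))
  where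
  δ-suc : ∀ z → δ (suc x) (suc z) * f (suc z) ≡ δ x z * f (suc z)
  δ-suc z with x ≟ z
  ... | yes _ = refl
  ... | no _ = refl

∑-linear₃ : ∀ {n} p q s (u v w : Fin n → ℕ) →
  ∑[ i < n ] (p * u i + q * v i + s * w i) ≡ p * sum u + q * sum v + s * sum w
∑-linear₃ {n} p q s u v w = begin
  ∑[ i < n ] (p * u i + q * v i + s * w i)                      ≡⟨ ∑-distrib-+ (λ i → p * u i + q * v i) (λ i → s * w i) ⟩
  ∑[ i < n ] (p * u i + q * v i) + ∑[ i < n ] (s * w i)         ≡⟨ cong (_+ ∑[ i < n ] (s * w i)) (∑-distrib-+ (λ i → p * u i) (λ i → q * v i)) ⟩
  ∑[ i < n ] (p * u i) + ∑[ i < n ] (q * v i) + ∑[ i < n ] (s * w i)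
    ≡⟨ cong₂ _+_ (cong₂ _+_ (*-distribˡ-sum p u) (*-distribˡ-sum q v)) (*-distribˡ-sum s w) ⟨
  p * sum u + q * sum v + s * sum w                             ∎
  where open ≡-Reasoning

∑-mono-≤ : ∀ {n} {f g : Fin n → ℕ} → (∀ i → f i ≤ g i) → ∑[ i < n ] f i ≤ ∑[ i < n ] g i
∑-mono-≤ {zero} f≤g = z≤n
∑-mono-≤ {suc n} f≤g = +-mono-≤ (f≤g zero) (∑-mono-≤ (f≤g ∘ suc))

∑-mono-≤-rigid : ∀ {n} {f g : Fin n → ℕ} → (∀ i → f i ≤ g i) →
  ∑[ i < n ] g i ≤ ∑[ i < n ] f i → ∀ i → f i ≡ g i
∑-mono-≤-rigid {suc n} {f} {g} f≤g ∑g≤∑f = λ where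
    zero → head-≡
    (suc i) → ∑-mono-≤-rigid (f≤g ∘ suc) tail-≥ i
  where
  ∑f′≤∑g′ : ∑[ i < n ] f (suc i) ≤ ∑[ i < n ] g (suc i)
  ∑f′≤∑g′ = ∑-mono-≤ (f≤g ∘ suc)
  head-≡ : f zero ≡ g zero
  head-≡ = ≤-antisym (f≤g zero)
    (+-cancelʳ-≤ _ (g zero) (f zero) (≤-trans ∑g≤∑f (+-monoʳ-≤ (f zero) ∑f′≤∑g′)))
  tail-≥ : ∑[ i < n ] g (suc i) ≤ ∑[ i < n ] f (suc i)
  tail-≥ = +-cancelˡ-≤ (g zero) _ _ (subst (λ v → _ ≤ v + _) head-≡ ∑g≤∑f)

∑-positive : ∀ {n} (f : Fin n → ℕ) → 0 < ∑[ i < n ] f i → ∃ λ i → 0 < f i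
∑-positive {suc n} f 0<∑ with f zero in eq
... | suc _ = zero , subst (0 <_) (sym eq) (s≤s z≤n)
... | zero = let i , 0<f[1+i] = ∑-positive (f ∘ suc) 0<∑ in suc i , 0<f[1+i]

cross-cancel : ∀ c d x y → c * x + d * y ≡ d * x + c * y → c ≡ d ⊎ x ≡ y
cross-cancel c d x y eq =
  [ (λ c≤d → ≤-case c≤d eq) , (λ d≤c → map₁ sym (≤-case d≤c (sym eq))) ]′ (≤-total c d)
  where
  ≤-case : ∀ {c d} → c ≤ d → c * x + d * y ≡ d * x + c * y → c ≡ d ⊎ x ≡ y
  ≤-case {c} c≤d eq with m≤n⇒∃[o]m+o≡n c≤d
  ... | o , refl = cancel-o o (+-cancelʳ-≡ (c * x + c * y) (o * y) (o * x) (begin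
    o * y + (c * x + c * y) ≡⟨ shuffle c o x y ⟩
    c * x + (c + o) * y     ≡⟨ eq ⟩
    (c + o) * x + c * y     ≡⟨ unshuffle c o x y ⟩
    o * x + (c * x + c * y) ∎))
    where
    open ≡-Reasoning
    shuffle : ∀ c o x y → o * y + (c * x + c * y) ≡ c * x + (c + o) * y
    shuffle = solve-∀
    unshuffle : ∀ c o x y → (c + o) * x + c * y ≡ o * x + (c * x + c * y)
    unshuffle = solve-∀
    cancel-o : ∀ o → o * y ≡ o * x → c ≡ c + o ⊎ x ≡ y
    cancel-o zero _ = inj₁ (sym (+-identityʳ c))
    cancel-o (suc o) oy≡ox = inj₂ (*-cancelˡ-≡ x y (suc o) (sym oy≡ox))

equal-slopes : ∀ e c d u v → e + c * u ≡ d * u → e + c * v ≡ d * v → c ≡ d ⊎ u ≡ v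
equal-slopes e c d u v eu ev = cross-cancel c d u v (+-cancelˡ-≡ e _ _ (begin
  e + (c * u + d * v) ≡⟨ +-assoc e (c * u) (d * v) ⟨
  e + c * u + d * v   ≡⟨ cong (_+ d * v) eu ⟩
  d * u + d * v       ≡⟨ cong (d * u +_) ev ⟨
  d * u + (e + c * v) ≡⟨ +-exchange (d * u) e (c * v) ⟩
  e + (d * u + c * v) ∎))
  where
  open ≡-Reasoning
  +-exchange : ∀ p q s → p + (q + s) ≡ q + (p + s)
  +-exchange = solve-∀

module _ {n : ℕ} (G : Graph n) where

  nbr : Fin n → Fin n → ℕ
  nbr x y = ⟦ adj G x y ⟧

  nbr-sym : ∀ x y → nbr x y ≡ nbr y x
  nbr-sym x y = cong ⟦_⟧ (adj-sym G x y)

  closedNbr : Fin n → Fin n → ℕ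
  closedNbr x y = nbr x y + δ x y

  closedCommonNbrs : Fin n → Fin n → ℕ
  closedCommonNbrs x z = ∑[ y < n ] (closedNbr x y * closedNbr y z)

  degree≡∑ : ∀ x → degree G x ≡ ∑[ y < n ] nbr x y
  degree≡∑ x = length-filter-tabulate (adj G x) id

  commonNbrs≡∑ : ∀ x z → commonNbrs G x z ≡ ∑[ y < n ] (nbr x y * nbr z y)
  commonNbrs≡∑ x z = trans (length-filter-tabulate (λ y → adj G x y ∧ adj G z y) id)
    (sum-cong-≗ (λ y → ⟦∧⟧≡* (adj G x y) (adj G z y)))

  ∑-distrib-closedNbr : ∀ x (f : Fin n → ℕ) →
    ∑[ y < n ] (closedNbr x y * f y) ≡ ∑[ y < n ] (nbr x y * f y) + f x
  ∑-distrib-closedNbr x f = begin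
    ∑[ y < n ] (closedNbr x y * f y)                         ≡⟨ sum-cong-≗ (λ y → *-distribʳ-+ (f y) (nbr x y) (δ x y)) ⟩
    ∑[ y < n ] (nbr x y * f y + δ x y * f y)                 ≡⟨ ∑-distrib-+ (λ y → nbr x y * f y) (λ y → δ x y * f y) ⟩
    ∑[ y < n ] (nbr x y * f y) + ∑[ y < n ] (δ x y * f y)    ≡⟨ cong (∑[ y < n ] (nbr x y * f y) +_) (∑-δ x f) ⟩
    ∑[ y < n ] (nbr x y * f y) + f x                         ∎
    where open ≡-Reasoning

  closedNbhdSum≡∑ : ∀ f x → closedNbhdSum G f x ≡ ∑[ y < n ] (closedNbr x y * f y)
  closedNbhdSum≡∑ f x = begin
    closedNbhdSum G f x                 ≡⟨ cong (_+ f x) (sum-map-tabulate (λ y → if adj G x y then f y else 0) id) ⟩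
    ∑[ y < n ] (if adj G x y then f y else 0) + f x
      ≡⟨ cong (_+ f x) (sum-cong-≗ (λ y → if-then-0≡⟦⟧* (adj G x y) (f y))) ⟩
    ∑[ y < n ] (nbr x y * f y) + f x    ≡⟨ ∑-distrib-closedNbr x f ⟨
    ∑[ y < n ] (closedNbr x y * f y)    ∎
    where open ≡-Reasoning

  ∑-closedNbr : ∀ x → ∑[ y < n ] closedNbr x y ≡ suc (degree G x)
  ∑-closedNbr x = begin
    ∑[ y < n ] closedNbr x y          ≡⟨ sum-cong-≗ (λ y → *-identityʳ (closedNbr x y)) ⟨
    ∑[ y < n ] (closedNbr x y * 1)    ≡⟨ ∑-distrib-closedNbr x (λ _ → 1) ⟩
    ∑[ y < n ] (nbr x y * 1) + 1      ≡⟨ cong (_+ 1) (trans (sum-cong-≗ (λ y → *-identityʳ (nbr x y))) (sym (degree≡∑ x))) ⟩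
    degree G x + 1                    ≡⟨ +-comm (degree G x) 1 ⟩
    suc (degree G x)                  ∎
    where open ≡-Reasoning

  closedCommonNbrs≡ : ∀ x z → closedCommonNbrs x z ≡ commonNbrs G x z + nbr x z + closedNbr x z
  closedCommonNbrs≡ x z = begin
    ∑[ y < n ] (closedNbr x y * closedNbr y z)
      ≡⟨ ∑-distrib-closedNbr x (λ y → closedNbr y z) ⟩
    ∑[ y < n ] (nbr x y * closedNbr y z) + closedNbr x z
      ≡⟨ cong (_+ closedNbr x z) (begin
        ∑[ y < n ] (nbr x y * (nbr y z + δ y z))
          ≡⟨ sum-cong-≗ (λ y → *-distribˡ-+ (nbr x y) (nbr y z) (δ y z)) ⟩
        ∑[ y < n ] (nbr x y * nbr y z + nbr x y * δ y z)
          ≡⟨ ∑-distrib-+ (λ y → nbr x y * nbr y z) (λ y → nbr x y * δ y z) ⟩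
        ∑[ y < n ] (nbr x y * nbr y z) + ∑[ y < n ] (nbr x y * δ y z)
          ≡⟨ cong₂ _+_ (trans (sum-cong-≗ (λ y → cong (nbr x y *_) (nbr-sym y z))) (sym (commonNbrs≡∑ x z)))
                       (trans (sum-cong-≗ (λ y → trans (*-comm (nbr x y) (δ y z)) (cong (_* nbr x y) (δ-sym y z))))
                              (∑-δ z (nbr x))) ⟩
        commonNbrs G x z + nbr x z ∎) ⟩
    commonNbrs G x z + nbr x z + closedNbr x z ∎
    where open ≡-Reasoning

  nonNbr : Fin n → Fin n → ℕ
  nonNbr x z = ⟦ not (adj G x z ∨ ⌊ x ≟ z ⌋) ⟧

  nonNbr+closedNbr≡1 : ∀ x z → nonNbr x z + closedNbr x z ≡ 1
  nonNbr+closedNbr≡1 x z with x ≟ z | adj G x z in adj[x,z]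
  ... | yes refl | false = refl
  ... | yes refl | true = contradiction adj[x,z] (not-¬ (adj-irrefl G x))
  ... | no _ | true = refl
  ... | no _ | false = refl

  commonNbrs-self : ∀ x → commonNbrs G x x ≡ degree G x
  commonNbrs-self x = begin
    commonNbrs G x x             ≡⟨ commonNbrs≡∑ x x ⟩
    ∑[ y < n ] (nbr x y * nbr x y) ≡⟨ sum-cong-≗ (λ y → ⟦⟧*⟦⟧-idem (adj G x y)) ⟩
    ∑[ y < n ] nbr x y           ≡⟨ degree≡∑ x ⟨
    degree G x                   ∎
    where
    open ≡-Reasoning
    ⟦⟧*⟦⟧-idem : ∀ p → ⟦ p ⟧ * ⟦ p ⟧ ≡ ⟦ p ⟧
    ⟦⟧*⟦⟧-idem true = refl
    ⟦⟧*⟦⟧-idem false = refl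

  nbrSum : (Fin n → ℕ) → Fin n → ℕ
  nbrSum ℓ x = ∑[ z < n ] (nbr x z * ℓ z)

  nonNbrSum : (Fin n → ℕ) → Fin n → ℕ
  nonNbrSum ℓ x = ∑[ z < n ] (nonNbr x z * ℓ z)

  module _ {ℓ : Fin n → ℕ} {k : ℕ} (magic : ∀ x → closedNbhdSum G ℓ x ≡ k) where

    nbrSum+ℓ≡k : ∀ x → nbrSum ℓ x + ℓ x ≡ k
    nbrSum+ℓ≡k x = trans (sym (∑-distrib-closedNbr x ℓ)) (trans (sym (closedNbhdSum≡∑ ℓ x)) (magic x))

    nonNbrSum+k≡∑ℓ : ∀ x → nonNbrSum ℓ x + k ≡ ∑[ z < n ] ℓ z
    nonNbrSum+k≡∑ℓ x = begin
      nonNbrSum ℓ x + k                                         ≡⟨ cong (nonNbrSum ℓ x +_) (trans (sym (magic x)) (closedNbhdSum≡∑ ℓ x)) ⟩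
      nonNbrSum ℓ x + ∑[ z < n ] (closedNbr x z * ℓ z)          ≡⟨ ∑-distrib-+ (λ z → nonNbr x z * ℓ z) (λ z → closedNbr x z * ℓ z) ⟨
      ∑[ z < n ] (nonNbr x z * ℓ z + closedNbr x z * ℓ z)       ≡⟨ sum-cong-≗ (λ z → *-distribʳ-+ (ℓ z) (nonNbr x z) (closedNbr x z)) ⟨
      ∑[ z < n ] ((nonNbr x z + closedNbr x z) * ℓ z)           ≡⟨ sum-cong-≗ (λ z → trans (cong (_* ℓ z) (nonNbr+closedNbr≡1 x z)) (*-identityˡ (ℓ z))) ⟩
      ∑[ z < n ] ℓ z                                            ∎
      where open ≡-Reasoning

    nonNbrSum-const : ∀ x y → nonNbrSum ℓ x ≡ nonNbrSum ℓ y
    nonNbrSum-const x y = +-cancelʳ-≡ k _ _ (trans (nonNbrSum+k≡∑ℓ x) (sym (nonNbrSum+k≡∑ℓ y)))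

    nbrSum-injective : ∀ {x y} → nbrSum ℓ x ≡ nbrSum ℓ y → ℓ x ≡ ℓ y
    nbrSum-injective {x} {y} same = +-cancelˡ-≡ (nbrSum ℓ x) (ℓ x) (ℓ y)
      (trans (nbrSum+ℓ≡k x) (trans (sym (nbrSum+ℓ≡k y)) (cong (_+ ℓ y) (sym same))))

    ∑-closedCommonNbrs-magic : ∀ x → ∑[ z < n ] (closedCommonNbrs x z * ℓ z) ≡ suc (degree G x) * k
    ∑-closedCommonNbrs-magic x = begin
      ∑[ z < n ] (∑[ y < n ] (C x y * C y z) * ℓ z)   ≡⟨ sum-cong-≗ (λ z → *-distribʳ-sum (ℓ z) (λ y → C x y * C y z)) ⟩
      ∑[ z < n ] ∑[ y < n ] (C x y * C y z * ℓ z)     ≡⟨ sum-cong-≗ (λ z → sum-cong-≗ (λ y → *-assoc (C x y) (C y z) (ℓ z))) ⟩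
      ∑[ z < n ] ∑[ y < n ] (C x y * (C y z * ℓ z))   ≡⟨ ∑-comm (λ z y → C x y * (C y z * ℓ z)) ⟩
      ∑[ y < n ] ∑[ z < n ] (C x y * (C y z * ℓ z))   ≡⟨ sum-cong-≗ (λ y → *-distribˡ-sum (C x y) (λ z → C y z * ℓ z)) ⟨
      ∑[ y < n ] (C x y * ∑[ z < n ] (C y z * ℓ z))   ≡⟨ sum-cong-≗ (λ y → cong (C x y *_) (trans (sym (closedNbhdSum≡∑ ℓ y)) (magic y))) ⟩
      ∑[ y < n ] (C x y * k)                          ≡⟨ *-distribʳ-sum k (C x) ⟨
      ∑[ y < n ] C x y * k                            ≡⟨ cong (_* k) (∑-closedNbr x) ⟩
      suc (degree G x) * k                            ∎
      where
      open ≡-Reasoning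
      C : Fin n → Fin n → ℕ
      C = closedNbr

  -- With degree r = a + 1, the neighbourhood of x is its common neighbourhood with any
  -- neighbour y, plus y itself; so N(x) ⊆ N[y] whenever x ~ y.
  nbrhood-is-clique : ∀ {r a} → Regular G r → (∀ x y → Adj G x y → commonNbrs G x y ≡ a) → 1 + a ≡ r →
    ∀ {x y z} → Adj G x y → Adj G x z → y ≢ z → Adj G y z
  nbrhood-is-clique {r} {a} regular common-adj 1+a≡r {x} {y} {z} x~y x~z y≢z = ⟦⟧≡1⇒true (begin
    nbr y z                        ≡⟨ m≡1*m+0 (nbr y z) ⟩
    1 * nbr y z + 0                ≡⟨ cong₂ (λ p q → p * nbr y z + q) (cong ⟦_⟧ x~z) (δ-≢ y≢z) ⟨
    nbr x z * nbr y z + δ y z      ≡⟨ ∑-mono-≤-rigid common≤nbr (≤-reflexive (trans ∑nbr (sym ∑common))) z ⟩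
    nbr x z                        ≡⟨ cong ⟦_⟧ x~z ⟩
    1                              ∎)
    where
    open ≡-Reasoning
    m≡1*m+0 : ∀ m → m ≡ 1 * m + 0
    m≡1*m+0 = solve-∀
    common≤nbr : ∀ w → nbr x w * nbr y w + δ y w ≤ nbr x w
    common≤nbr w with y ≟ w
    ... | yes refl rewrite adj-irrefl G y | x~y = ≤-refl
    ... | no _ = ≤-trans (≤-reflexive (+-identityʳ _))
                   (≤-trans (*-monoʳ-≤ (nbr x w) (⟦⟧≤1 (adj G y w))) (≤-reflexive (*-identityʳ (nbr x w))))
    ∑nbr : ∑[ w < n ] nbr x w ≡ suc a
    ∑nbr = trans (sym (degree≡∑ x)) (trans (regular x) (sym 1+a≡r))
    ∑common : ∑[ w < n ] (nbr x w * nbr y w + δ y w) ≡ suc a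
    ∑common = begin
      ∑[ w < n ] (nbr x w * nbr y w + δ y w)              ≡⟨ ∑-distrib-+ (λ w → nbr x w * nbr y w) (δ y) ⟩
      ∑[ w < n ] (nbr x w * nbr y w) + ∑[ w < n ] δ y w   ≡⟨ cong₂ _+_ (trans (sym (commonNbrs≡∑ x y)) (common-adj x y x~y))
                                                                  (trans (sum-cong-≗ (λ w → sym (*-identityʳ (δ y w)))) (∑-δ y (λ _ → 1))) ⟩
      a + 1                                                ≡⟨ +-comm a 1 ⟩
      suc a                                                ∎

  complete-if-nbrhoods-are-cliques : (∀ {x y z} → Adj G x y → Adj G x z → y ≢ z → Adj G y z) →
    (∀ x y → x ≢ y → ¬ Adj G x y → 0 < commonNbrs G x y) → ∀ x y → x ≢ y → Adj G x y
  complete-if-nbrhoods-are-cliques closed has-common x y x≢y with adj G x y Bool.≟ true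
  ... | yes x~y = x~y
  ... | no ¬x~y with ∑-positive (λ w → nbr x w * nbr y w)
                       (subst (0 <_) (commonNbrs≡∑ x y) (has-common x y x≢y ¬x~y))
  ... | z , 0<nbr[x,z]*nbr[y,z] with ⟦⟧*⟦⟧-positive (adj G x z) (adj G y z) 0<nbr[x,z]*nbr[y,z]
  ... | x~z , y~z = ⊥-elim (¬x~y (closed (trans (adj-sym G z x) x~z) (trans (adj-sym G z y) y~z) x≢y))

module _ {n : ℕ} (G : Graph n) {r a b : ℕ} (regular : Regular G r)
         (common-adj : ∀ x y → Adj G x y → commonNbrs G x y ≡ a)
         (common-nonadj : ∀ x y → x ≢ y → ¬ Adj G x y → commonNbrs G x y ≡ b) where

  commonNbrs-srg : ∀ x z → commonNbrs G x z ≡ b * nonNbr G x z + a * nbr G x z + r * δ x z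
  commonNbrs-srg x z with x ≟ z | adj G x z in adj[x,z]
  ... | yes refl | true = contradiction adj[x,z] (not-¬ (adj-irrefl G x))
  ... | yes refl | false = trans (trans (commonNbrs-self G x) (regular x)) (r≡ r a b)
    where
    r≡ : ∀ r a b → r ≡ b * 0 + a * 0 + r * 1
    r≡ = solve-∀
  ... | no _ | true = trans (common-adj x z adj[x,z]) (a≡ r a b)
    where
    a≡ : ∀ r a b → a ≡ b * 0 + a * 1 + r * 0
    a≡ = solve-∀
  ... | no x≢z | false = trans (common-nonadj x z x≢z (not-¬ adj[x,z])) (b≡ r a b)
    where
    b≡ : ∀ r a b → b ≡ b * 1 + a * 0 + r * 0
    b≡ = solve-∀

  closedCommonNbrs-srg : ∀ x z →
    closedCommonNbrs G x z ≡ b * nonNbr G x z + (2 + a) * nbr G x z + (1 + r) * δ x z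
  closedCommonNbrs-srg x z = trans (closedCommonNbrs≡ G x z)
    (trans (cong (λ c → c + nbr G x z + closedNbr G x z) (commonNbrs-srg x z))
           (collect b (nonNbr G x z) a (nbr G x z) r (δ x z)))
    where
    collect : ∀ b N a A r D → b * N + a * A + r * D + A + (A + D) ≡ b * N + (2 + a) * A + (1 + r) * D
    collect = solve-∀

  module _ {ℓ : Fin n → ℕ} {k : ℕ} (magic : ∀ x → closedNbhdSum G ℓ x ≡ k) where

    double-count : ∀ x → b * nonNbrSum G ℓ x + (2 + a) * nbrSum G ℓ x + (1 + r) * ℓ x ≡ (1 + r) * k
    double-count x = begin
      b * nonNbrSum G ℓ x + (2 + a) * nbrSum G ℓ x + (1 + r) * ℓ x
        ≡⟨ cong (b * nonNbrSum G ℓ x + (2 + a) * nbrSum G ℓ x +_) (cong ((1 + r) *_) (∑-δ x ℓ)) ⟨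
      b * nonNbrSum G ℓ x + (2 + a) * nbrSum G ℓ x + (1 + r) * ∑[ z < n ] (δ x z * ℓ z)
        ≡⟨ ∑-linear₃ b (2 + a) (1 + r) (λ z → nonNbr G x z * ℓ z) (λ z → nbr G x z * ℓ z) (λ z → δ x z * ℓ z) ⟨
      ∑[ z < n ] (b * (nonNbr G x z * ℓ z) + (2 + a) * (nbr G x z * ℓ z) + (1 + r) * (δ x z * ℓ z))
        ≡⟨ sum-cong-≗ (λ z → trans (cong (_* ℓ z) (closedCommonNbrs-srg x z))
                                   (distribute b (nonNbr G x z) (2 + a) (nbr G x z) (1 + r) (δ x z) (ℓ z))) ⟨
      ∑[ z < n ] (closedCommonNbrs G x z * ℓ z)    ≡⟨ ∑-closedCommonNbrs-magic G magic x ⟩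
      suc (degree G x) * k                          ≡⟨ cong (λ d → suc d * k) (regular x) ⟩
      (1 + r) * k                                   ∎
      where
      open ≡-Reasoning
      distribute : ∀ b N c A d D l → (b * N + c * A + d * D) * l ≡ b * (N * l) + c * (A * l) + d * (D * l)
      distribute = solve-∀

    slope : ∀ x → b * nonNbrSum G ℓ x + (2 + a) * nbrSum G ℓ x ≡ (1 + r) * nbrSum G ℓ x
    slope x = +-cancelʳ-≡ ((1 + r) * ℓ x) _ _ (begin
      b * nonNbrSum G ℓ x + (2 + a) * nbrSum G ℓ x + (1 + r) * ℓ x  ≡⟨ double-count x ⟩
      (1 + r) * k                                                  ≡⟨ cong ((1 + r) *_) (nbrSum+ℓ≡k G magic x) ⟨
      (1 + r) * (nbrSum G ℓ x + ℓ x)                               ≡⟨ *-distribˡ-+ (1 + r) (nbrSum G ℓ x) (ℓ x) ⟩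
      (1 + r) * nbrSum G ℓ x + (1 + r) * ℓ x                       ∎)
      where open ≡-Reasoning

    -- nonNbrSum is the same at every vertex, so the slope equation is affine in nbrSum,
    -- which differs at vertices with different labels.
    1+a≡r : ∀ x y → ℓ x ≢ ℓ y → 1 + a ≡ r
    1+a≡r x y ℓx≢ℓy =
      [ suc-injective , (λ same-nbrSum → contradiction (nbrSum-injective G magic same-nbrSum) ℓx≢ℓy) ]′
      (equal-slopes (b * nonNbrSum G ℓ x) (2 + a) (1 + r) (nbrSum G ℓ x) (nbrSum G ℓ y)
        (slope x) (subst (λ e → b * e + (2 + a) * nbrSum G ℓ y ≡ _) (nonNbrSum-const G magic y x) (slope y)))

complete⇒≅ : ∀ {n} (G : Graph n) → (∀ x y → x ≢ y → Adj G x y) → G ≅ complete n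
complete⇒≅ G adjacent = ⤖-id _ , adj≡
  where
  adj≡ : ∀ x y → adj G x y ≡ adj (complete _) x y
  adj≡ x y with x ≟ y
  ... | yes refl = adj-irrefl G x
  ... | no x≢y = adjacent x y x≢y

mainTheorem9 : ∀ (n : ℕ) (G : Graph n) → StronglyRegular G → ClosedDistanceMagic G → G ≅ complete n
mainTheorem9 n G (r , a , b , regular , b≥1 , common-adj , common-nonadj) (σ , k , _ , magic) =
  complete⇒≅ G adjacent
  where
  ℓ : Fin n → ℕ
  ℓ v = suc (toℕ (Bijection.to σ v))
  ℓ-injective : ∀ {x y} → ℓ x ≡ ℓ y → x ≡ y
  ℓ-injective = Bijection.injective σ ∘ toℕ-injective ∘ suc-injective
  has-common : ∀ x y → x ≢ y → ¬ Adj G x y → 0 < commonNbrs G x y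
  has-common x y x≢y ¬x~y = subst (0 <_) (sym (common-nonadj x y x≢y ¬x~y)) b≥1
  adjacent : ∀ x y → x ≢ y → Adj G x y
  adjacent x y x≢y = complete-if-nbrhoods-are-cliques G
    (nbrhood-is-clique G regular common-adj
      (1+a≡r G regular common-adj common-nonadj magic x y (x≢y ∘ ℓ-injective)))
    has-common x y x≢y
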